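{- Every $4$-unitrade of cardinality $9$ is equivalent to $P=\{\{1,2,5,6\},\{1,3,5,6\},\{2,3,5,6\},\{1,2,4,6\},\{1,3,4,6\},\{2,3,4,6\},\{1,2,4,5\},\{1,3,4,5\},\{2,3,4,5\}\}$ (and $P$ is a $4$-unitrade).
   Context: A $k$-unitrade on a finite set $V$ is a collection $U$ of $k$-element subsets of $V$ such that every $(k-1)$-element subset of $V$ is contained in an even number of blocks of $U$. Two unitrades $U_1$ on $V_1$ and $U_2$ on $V_2$ are equivalent if there is an injection $f:V_1\to V_2$ with $U_2=\{f(u):u\in U_1\}$ (or vice versa). -}

module Defs where

open import Data.Nat using (ℕ; _+_)
open import Data.Nat.Divisibility using (_∣_)
open import Data.Fin using (Fin)
open import Data.Fin.Subset using (Subset; ∣_∣; _⊆_; _∈_; inside; outside)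
open import Data.Fin.Subset.Properties using (_⊆?_)
open import Data.List using (List; []; _∷_; length; filter)
open import Data.List.Relation.Unary.All using (All)
open import Data.List.Relation.Unary.Unique.Propositional using (Unique)
import Data.List.Membership.Propositional as LM
open import Data.Vec using (_∷_; [])
open import Data.Product using (Σ; _×_; ∃)
open import Data.Sum using (_⊎_)
open import Function.Bundles using (_⇔_)
open import Function.Definitions using (Injective)
open import Relation.Binary.PropositionalEquality using (_≡_)

-- A finite set V is modelled as Fin n; a subset of V as Subset n.
-- A collection of blocks is a duplicate-free list of subsets of Fin n.

deg : ∀ {n} → Subset n → List (Subset n) → ℕ
deg T U = length (filter (T ⊆?_) U)

record Unitrade (k n : ℕ) (U : List (Subset n)) : Set where
  field
    distinct : Unique U
    blockSize : All (λ b → ∣ b ∣ ≡ k) U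
    even : ∀ (T : Subset n) → ∣ T ∣ + 1 ≡ k → 2 ∣ deg T U

IsImage : ∀ {n m} → (Fin n → Fin m) → Subset n → Subset m → Set
IsImage {n} f u s = ∀ j → (j ∈ s) ⇔ (∃ λ (i : Fin n) → i ∈ u × f i ≡ j)

ImageOf : ∀ {n m} → (Fin n → Fin m) → List (Subset n) → List (Subset m) → Set
ImageOf f U₁ U₂ =
  (∀ s → s LM.∈ U₂ → ∃ λ u → u LM.∈ U₁ × IsImage f u s) ×
  (∀ u → u LM.∈ U₁ → ∃ λ s → s LM.∈ U₂ × IsImage f u s)

Equivalent : ∀ {n m} → List (Subset n) → List (Subset m) → Set
Equivalent {n} {m} U₁ U₂ =
  (Σ (Fin n → Fin m) λ f → Injective _≡_ _≡_ f × ImageOf f U₁ U₂) ⊎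
  (Σ (Fin m → Fin n) λ g → Injective _≡_ _≡_ g × ImageOf g U₂ U₁)

-- ground set {1,…,6} is Fin 6 with point i represented by Fin index i-1
P : List (Subset 6)
P =
  (inside ∷ inside ∷ outside ∷ outside ∷ inside ∷ inside ∷ []) ∷
  (inside ∷ outside ∷ inside ∷ outside ∷ inside ∷ inside ∷ []) ∷
  (outside ∷ inside ∷ inside ∷ outside ∷ inside ∷ inside ∷ []) ∷
  (inside ∷ inside ∷ outside ∷ inside ∷ outside ∷ inside ∷ []) ∷
  (inside ∷ outside ∷ inside ∷ inside ∷ outside ∷ inside ∷ []) ∷
  (outside ∷ inside ∷ inside ∷ inside ∷ outside ∷ inside ∷ []) ∷
  (inside ∷ inside ∷ outside ∷ inside ∷ inside ∷ outside ∷ []) ∷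
  (inside ∷ outside ∷ inside ∷ inside ∷ inside ∷ outside ∷ []) ∷
  (outside ∷ inside ∷ inside ∷ inside ∷ inside ∷ outside ∷ []) ∷
  []

module Submission where

-- A verified exhaustive search. A partial configuration is an injection ρ : Fin k → Fin n with a
-- list L of blocks on Fin k whose images are distinct blocks of U. If a 3-set S lies in an odd
-- number of blocks of L, then, since ρ(S) lies in an even number of blocks of U, some block of U
-- outside ρ(L) contains ρ(S); its fourth point is either some ρ(i) or a new point. If there is no
-- such S, any block of U outside ρ(L) is adjoined, ρ being extended by its points outside the
-- range of ρ. Each branch adjoins one block, so after 9 steps ρ(L) is all of U; then an odd 3-set
-- is contradictory, and otherwise an injection Fin 6 → Fin k found by search maps P onto L.

open import Defs
open import Data.Bool using (Bool; true; T; _∧_; _∨_)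
open import Data.Bool.ListAction using (all)
open import Data.Bool.Properties using (T-∧; T-∨) renaming (_≟_ to _≟ᵇ_)
open import Data.Empty using (⊥-elim)
open import Data.Fin using (Fin; zero; suc)
open import Data.Fin.Properties using () renaming (any? to anyFin?; _≟_ to _≟ᶠ_)
open import Data.Fin.Subset using (Subset; inside; outside; _∈_; _∉_; _⊆_; _∪_; _-_; ⁅_⁆; ⊥; ⊤; ∣_∣)
open import Data.Fin.Subset.Properties
  using (_∈?_; _⊆?_; ∉⊥; x∈⁅x⁆; x∈⁅y⁆⇒x≡y; x∈p∪q⁺; x∈p∪q⁻; ⊆-antisym; ∪-identityˡ; ∣⊥∣≡0;
         p⊆q⇒∣p∣≤∣q∣; p⊂q⇒∣p∣<∣q∣; p─q⊆p; x∈p∧x≢y⇒x∈p-y; x∈p⇒∣p-x∣<∣p∣)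
open import Data.List using (List; []; _∷_; map; filter; concatMap; allFin; upTo; find; length)
  renaming (_++_ to _++ᴸ_)
open import Data.List.Membership.Propositional using (lose) renaming (find to find∈; _∈_ to _∈ᴸ_; _∉_ to _∉ᴸ_)
open import Data.List.Membership.Propositional.Properties
  using (∈-∃++; ∈-++⁻; ∈-++⁺ˡ; ∈-++⁺ʳ; ∈-map⁺; ∈-map⁻; ∈-filter⁺; ∈-filter⁻; ∈-allFin; ∈-upTo⁺)
open import Data.List.Properties using (length-++-sucʳ; length-map; map-∘; map-cong)
open import Data.List.Relation.Binary.Subset.Propositional using () renaming (_⊆_ to _⊆ᴸ_)
open import Data.List.Relation.Unary.All using (All)
import Data.List.Relation.Unary.All as All
open import Data.List.Relation.Unary.All.Properties using (all⁺)
import Data.List.Relation.Unary.AllPairs as AllPairs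
open import Data.List.Relation.Unary.Any using (Any; any?; here; there)
open import Data.List.Relation.Unary.Unique.Propositional using (Unique; []; _∷_)
open import Data.List.Relation.Unary.Unique.Propositional.Properties using (filter⁺)
open import Data.Maybe.Base using (Maybe; just; nothing)
open import Data.Maybe.Relation.Unary.All as Maybe using (just; nothing)
open import Data.Nat using (ℕ; zero; suc; _+_; _∸_; _<_; _≤_; z≤n; s≤s; _≟_)
open import Data.Nat.Divisibility using (_∣_; _∣?_)
open import Data.Nat.Induction using (<-wellFounded)
open import Data.Nat.Properties
  using (<⇒≱; ≤-reflexive; ≤∧≢⇒<; +-suc; m≤n+m; m≤m+n; m+n∸m≡n; +-cancelʳ-≡)
open import Data.Product using (∃; _×_; _,_; proj₁; proj₂)
open import Data.Sum using (_⊎_; inj₁; inj₂; [_,_]′; swap)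
open import Data.Vec using (Vec; []; _∷_; _++_; lookup; here; there) renaming (map to mapᵛ)
open import Data.Vec.Properties using (≡-dec; []=⇒lookup; lookup⇒[]=; lookup-map)
open import Data.Vec.Relation.Unary.All using ([]; _∷_) renaming (All to Allᵛ)
import Data.Vec.Relation.Unary.All as Allᵛ
open import Data.Vec.Relation.Unary.All.Properties using (lookup⁺; ++⁺)
open import Data.Vec.Relation.Unary.AllPairs using (allPairs?)
import Data.Vec.Relation.Unary.Any as Anyᵛ
open import Data.Vec.Relation.Unary.Any.Properties using (lookup-index)
open import Data.Vec.Relation.Unary.Unique.Propositional using ([]; _∷_) renaming (Unique to Uniqueᵛ)
open import Data.Vec.Relation.Unary.Unique.Propositional.Properties using (lookup-injective; map⁺)
open import Function.Base using (_∘_; id; case_of_)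
open import Function.Bundles using (mk⇔; Equivalence)
open import Function.Definitions using (Injective)
open import Induction.WellFounded using (Acc; acc)
open import Level using (Level)
open import Relation.Binary.Definitions using (DecidableEquality)
open import Relation.Binary.PropositionalEquality
  using (_≡_; _≢_; refl; sym; trans; cong; subst; subst₂; module ≡-Reasoning)
open ≡-Reasoning
open import Relation.Nullary using (yes; no; ¬_; ¬?; _×-dec_; contradiction)
open import Relation.Nullary.Decidable using (decidable-stable; isYes; toSum; toWitness)
open import Relation.Unary using (Pred; Decidable)

private
  variable
    k m n : ℕ

∣⁅x⁆∪p∣ : ∀ {x : Fin n} {p} → x ∉ p → ∣ ⁅ x ⁆ ∪ p ∣ ≡ suc ∣ p ∣
∣⁅x⁆∪p∣ {x = zero}  {inside  ∷ p} x∉p = contradiction here x∉p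
∣⁅x⁆∪p∣ {x = zero}  {outside ∷ p} x∉p = cong (suc ∘ ∣_∣) (∪-identityˡ p)
∣⁅x⁆∪p∣ {x = suc x} {inside  ∷ p} x∉p = cong suc (∣⁅x⁆∪p∣ (x∉p ∘ there))
∣⁅x⁆∪p∣ {x = suc x} {outside ∷ p} x∉p = ∣⁅x⁆∪p∣ (x∉p ∘ there)

∣⊤++p∣ : ∀ j (p : Subset k) → ∣ ⊤ {n = j} ++ p ∣ ≡ j + ∣ p ∣
∣⊤++p∣ zero    p = refl
∣⊤++p∣ (suc j) p = cong suc (∣⊤++p∣ j p)

x∉p-x : ∀ {x : Fin n} p → x ∉ p - x
x∉p-x {x = zero}  (_ ∷ p) ()
x∉p-x {x = suc x} (_ ∷ p) (there x∈) = x∉p-x p x∈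

⁅x⁆∪p⊆q : ∀ {x : Fin n} {p q} → x ∈ q → p ⊆ q → ⁅ x ⁆ ∪ p ⊆ q
⁅x⁆∪p⊆q {x = x} {p} {q} x∈q p⊆q y∈ with x∈p∪q⁻ ⁅ x ⁆ p y∈
... | inj₁ y∈⁅x⁆ = subst (_∈ q) (sym (x∈⁅y⁆⇒x≡y x y∈⁅x⁆)) x∈q
... | inj₂ y∈p   = p⊆q y∈p

⁅x⁆∪[p-x]≡p : ∀ {x : Fin n} {p} → x ∈ p → ⁅ x ⁆ ∪ (p - x) ≡ p
⁅x⁆∪[p-x]≡p {x = x} {p} x∈p = ⊆-antisym (⁅x⁆∪p⊆q x∈p (p─q⊆p p ⁅ x ⁆))
  (λ {y} y∈p → x∈p∪q⁺ (case y ≟ᶠ x of λ where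
    (yes refl) → inj₁ (x∈⁅x⁆ x)
    (no y≢x)   → inj₂ (x∈p∧x≢y⇒x∈p-y y∈p y≢x)))

∣p∣<∣q∣⇒∃∈q∉p : ∀ {p q : Subset n} → ∣ p ∣ < ∣ q ∣ → ∃ λ x → x ∈ q × x ∉ p
∣p∣<∣q∣⇒∃∈q∉p {p = p} {q} ∣p∣<∣q∣ with anyFin? (λ x → x ∈? q ×-dec ¬? (x ∈? p))
... | yes witness = witness
... | no ∄ = contradiction (p⊆q⇒∣p∣≤∣q∣ q⊆p) (<⇒≱ ∣p∣<∣q∣)
  where
  q⊆p : q ⊆ p
  q⊆p {x} x∈q = decidable-stable (x ∈? p) λ x∉p → ∄ (x , x∈q , x∉p)

p⊆q∧∣q∣≤∣p∣⇒p≡q : ∀ {p q : Subset n} → p ⊆ q → ∣ q ∣ ≤ ∣ p ∣ → p ≡ q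
p⊆q∧∣q∣≤∣p∣⇒p≡q {p = p} p⊆q ∣q∣≤∣p∣ = ⊆-antisym p⊆q λ {x} x∈q →
  decidable-stable (x ∈? p) λ x∉p → <⇒≱ (p⊂q⇒∣p∣<∣q∣ (p⊆q , x , x∈q , x∉p)) ∣q∣≤∣p∣

p⊆q∧∣q∣≡1+∣p∣⇒q≡⁅x⁆∪p : ∀ {p q : Subset n} → p ⊆ q → ∣ q ∣ ≡ suc ∣ p ∣ → ∃ λ x → x ∉ p × ⁅ x ⁆ ∪ p ≡ q
p⊆q∧∣q∣≡1+∣p∣⇒q≡⁅x⁆∪p p⊆q ∣q∣≡ =
  let x , x∈q , x∉p = ∣p∣<∣q∣⇒∃∈q∉p (≤-reflexive (sym ∣q∣≡)) in
  x , x∉p , p⊆q∧∣q∣≤∣p∣⇒p≡q (⁅x⁆∪p⊆q x∈q p⊆q) (≤-reflexive (trans ∣q∣≡ (sym (∣⁅x⁆∪p∣ x∉p))))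

module _ {a : Level} {A : Set a} where

  ∉⇒All≢ : ∀ {x : A} {xs} → x ∉ᴸ xs → All (x ≢_) xs
  ∉⇒All≢ {xs = xs} x∉xs = All.tabulate λ y∈xs x≡y → x∉xs (subst (_∈ᴸ xs) (sym x≡y) y∈xs)

  Unique-⊆⇒length≤ : ∀ {xs ys : List A} → Unique xs → xs ⊆ᴸ ys → length xs ≤ length ys
  Unique-⊆⇒length≤ [] _ = z≤n
  Unique-⊆⇒length≤ {x ∷ xs} (x∉xs ∷ uxs) x∷xs⊆ys with ∈-∃++ (x∷xs⊆ys (here refl))
  ... | ys₁ , ys₂ , refl = subst (suc (length xs) ≤_) (sym (length-++-sucʳ ys₁ x ys₂))
                             (s≤s (Unique-⊆⇒length≤ uxs xs⊆ys₁++ys₂))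
    where
    xs⊆ys₁++ys₂ : xs ⊆ᴸ ys₁ ++ᴸ ys₂
    xs⊆ys₁++ys₂ y∈xs with ∈-++⁻ ys₁ (x∷xs⊆ys (there y∈xs))
    ... | inj₁ y∈ys₁         = ∈-++⁺ˡ y∈ys₁
    ... | inj₂ (here y≡x)    = contradiction (sym y≡x) (All.lookup x∉xs y∈xs)
    ... | inj₂ (there y∈ys₂) = ∈-++⁺ʳ ys₁ y∈ys₂

module _ {a : Level} {A : Set a} (_≟_ : DecidableEquality A) where

  open import Data.List.Membership.DecPropositional _≟_ using () renaming (_∈?_ to _∈ᴸ?_)

  length<⇒∃∉ : ∀ {xs ys : List A} → Unique ys → length xs < length ys → ∃ λ y → y ∈ᴸ ys × y ∉ᴸ xs
  length<⇒∃∉ {xs} {ys} uys ∣xs∣<∣ys∣ with any? (λ y → ¬? (y ∈ᴸ? xs)) ys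
  ... | yes y∉xs = find∈ y∉xs
  ... | no ∄ = contradiction (Unique-⊆⇒length≤ uys ys⊆xs) (<⇒≱ ∣xs∣<∣ys∣)
    where
    ys⊆xs : ys ⊆ᴸ xs
    ys⊆xs {y} y∈ys = decidable-stable (y ∈ᴸ? xs) (∄ ∘ lose y∈ys)

  ⊆∧length≥⇒⊇ : ∀ {xs ys : List A} → Unique xs → xs ⊆ᴸ ys → length ys ≤ length xs → ys ⊆ᴸ xs
  ⊆∧length≥⇒⊇ {xs} uxs xs⊆ys ∣ys∣≤∣xs∣ {y} y∈ys = decidable-stable (y ∈ᴸ? xs) λ y∉xs →
    <⇒≱ (Unique-⊆⇒length≤ (∉⇒All≢ y∉xs ∷ uxs) λ { (here refl) → y∈ys ; (there x∈xs) → xs⊆ys x∈xs }) ∣ys∣≤∣xs∣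

  length-filter≢⇒∃∉ : ∀ {p} {P : Pred A p} (P? : Decidable P) {xs ys : List A} →
                      Unique xs → Unique ys → xs ⊆ᴸ ys → length (filter P? xs) ≢ length (filter P? ys) →
                      ∃ λ y → y ∈ᴸ ys × P y × y ∉ᴸ xs
  length-filter≢⇒∃∉ P? {xs} {ys} uxs uys xs⊆ys ≢ =
    let y , y∈ , y∉ = length<⇒∃∉ (filter⁺ P? uys) (≤∧≢⇒< (Unique-⊆⇒length≤ (filter⁺ P? uxs) filter-mono) ≢)
        y∈ys , Py = ∈-filter⁻ P? y∈
    in y , y∈ys , Py , λ y∈xs → y∉ (∈-filter⁺ P? y∈xs Py)
    where
    filter-mono : filter P? xs ⊆ᴸ filter P? ys
    filter-mono x∈ = let x∈xs , Px = ∈-filter⁻ P? x∈ in ∈-filter⁺ P? (xs⊆ys x∈xs) Px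

-- An injection Fin k → Fin n is represented by the vector of its values.
image : Vec (Fin n) k → Subset k → Subset n
image []      []            = ⊥
image (x ∷ ρ) (inside  ∷ c) = ⁅ x ⁆ ∪ image ρ c
image (x ∷ ρ) (outside ∷ c) = image ρ c

∈-image⁺ : ∀ (ρ : Vec (Fin n) k) c {i} → i ∈ c → lookup ρ i ∈ image ρ c
∈-image⁺ (x ∷ ρ) (inside  ∷ c) here        = x∈p∪q⁺ (inj₁ (x∈⁅x⁆ x))
∈-image⁺ (x ∷ ρ) (inside  ∷ c) (there i∈c) = x∈p∪q⁺ (inj₂ (∈-image⁺ ρ c i∈c))
∈-image⁺ (x ∷ ρ) (outside ∷ c) (there i∈c) = ∈-image⁺ ρ c i∈c

∈-image⁻ : ∀ (ρ : Vec (Fin n) k) c {x} → x ∈ image ρ c → ∃ λ i → i ∈ c × lookup ρ i ≡ x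
∈-image⁻ []      []            x∈ = contradiction x∈ ∉⊥
∈-image⁻ (y ∷ ρ) (inside  ∷ c) x∈ with x∈p∪q⁻ ⁅ y ⁆ (image ρ c) x∈
... | inj₁ x∈⁅y⁆ = zero , here , sym (x∈⁅y⁆⇒x≡y y x∈⁅y⁆)
... | inj₂ x∈ρc  = let i , i∈c , eq = ∈-image⁻ ρ c x∈ρc in suc i , there i∈c , eq
∈-image⁻ (y ∷ ρ) (outside ∷ c) x∈ =
  let i , i∈c , eq = ∈-image⁻ ρ c x∈ in suc i , there i∈c , eq

image-isImage : ∀ (ρ : Vec (Fin n) k) c → IsImage (lookup ρ) c (image ρ c)
image-isImage ρ c x = mk⇔ (∈-image⁻ ρ c) λ (i , i∈c , eq) → subst (_∈ image ρ c) eq (∈-image⁺ ρ c i∈c)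

IsImage⇒≡image : ∀ (ρ : Vec (Fin n) k) c {s} → IsImage (lookup ρ) c s → s ≡ image ρ c
IsImage⇒≡image ρ c {s} s≈ = ⊆-antisym
  (λ {x} x∈s → Equivalence.from (image-isImage ρ c x) (Equivalence.to (s≈ x) x∈s))
  (λ {x} x∈ρc → Equivalence.from (s≈ x) (Equivalence.to (image-isImage ρ c x) x∈ρc))

image-⁅⁆∪ : ∀ (ρ : Vec (Fin n) k) i c → image ρ (⁅ i ⁆ ∪ c) ≡ ⁅ lookup ρ i ⁆ ∪ image ρ c
image-⁅⁆∪ ρ i c = sym (IsImage⇒≡image ρ (⁅ i ⁆ ∪ c) λ x → mk⇔ to from)
  where
  to : ∀ {x} → x ∈ ⁅ lookup ρ i ⁆ ∪ image ρ c → ∃ λ j → j ∈ ⁅ i ⁆ ∪ c × lookup ρ j ≡ x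
  to x∈ with x∈p∪q⁻ ⁅ lookup ρ i ⁆ (image ρ c) x∈
  ... | inj₁ x∈⁅ρi⁆ = i , x∈p∪q⁺ (inj₁ (x∈⁅x⁆ i)) , sym (x∈⁅y⁆⇒x≡y _ x∈⁅ρi⁆)
  ... | inj₂ x∈ρc   = let j , j∈c , eq = ∈-image⁻ ρ c x∈ρc in j , x∈p∪q⁺ (inj₂ j∈c) , eq
  from : ∀ {x} → (∃ λ j → j ∈ ⁅ i ⁆ ∪ c × lookup ρ j ≡ x) → x ∈ ⁅ lookup ρ i ⁆ ∪ image ρ c
  from (j , j∈ , refl) with x∈p∪q⁻ ⁅ i ⁆ c j∈
  ... | inj₁ j∈⁅i⁆ = x∈p∪q⁺ (inj₁ (subst (λ j → lookup ρ j ∈ ⁅ lookup ρ i ⁆) (sym (x∈⁅y⁆⇒x≡y i j∈⁅i⁆)) (x∈⁅x⁆ _)))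
  ... | inj₂ j∈c   = x∈p∪q⁺ (inj₂ (∈-image⁺ ρ c j∈c))

image-map : ∀ (ρ : Vec (Fin n) m) (σ : Vec (Fin m) k) c → image ρ (image σ c) ≡ image (mapᵛ (lookup ρ) σ) c
image-map ρ σ c = IsImage⇒≡image (mapᵛ (lookup ρ) σ) c λ x → mk⇔ to from
  where
  to : ∀ {x} → x ∈ image ρ (image σ c) → ∃ λ i → i ∈ c × lookup (mapᵛ (lookup ρ) σ) i ≡ x
  to x∈ with ∈-image⁻ ρ (image σ c) x∈
  ... | _ , y∈ , refl =
    let i , i∈c , eq = ∈-image⁻ σ c y∈ in i , i∈c , trans (lookup-map i _ σ) (cong (lookup ρ) eq)
  from : ∀ {x} → (∃ λ i → i ∈ c × lookup (mapᵛ (lookup ρ) σ) i ≡ x) → x ∈ image ρ (image σ c)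
  from (i , i∈c , refl) = subst (_∈ image ρ (image σ c)) (sym (lookup-map i _ σ)) (∈-image⁺ ρ _ (∈-image⁺ σ c i∈c))

image-⊥++ : ∀ (τ : Vec (Fin n) m) (ρ : Vec (Fin n) k) c → image (τ ++ ρ) (⊥ ++ c) ≡ image ρ c
image-⊥++ []      ρ c = refl
image-⊥++ (_ ∷ τ) ρ c = image-⊥++ τ ρ c

image-⊆⁺ : ∀ (ρ : Vec (Fin n) k) {c d} → c ⊆ d → image ρ c ⊆ image ρ d
image-⊆⁺ ρ {c} {d} c⊆d x∈ with ∈-image⁻ ρ c x∈
... | i , i∈c , refl = ∈-image⁺ ρ d (c⊆d i∈c)

image-⊆⁻ : ∀ {ρ : Vec (Fin n) k} → Uniqueᵛ ρ → ∀ {c d} → image ρ c ⊆ image ρ d → c ⊆ d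
image-⊆⁻ {ρ = ρ} uρ {c} {d} ρc⊆ρd i∈c with ∈-image⁻ ρ d (ρc⊆ρd (∈-image⁺ ρ c i∈c))
... | j , j∈d , eq = subst (_∈ d) (lookup-injective uρ j _ eq) j∈d

∉-image : ∀ {ρ : Vec (Fin n) k} {x} → Allᵛ (x ≢_) ρ → ∀ c → x ∉ image ρ c
∉-image {ρ = ρ} x∉ρ c x∈ with ∈-image⁻ ρ c x∈
... | i , _ , eq = lookup⁺ x∉ρ i (sym eq)

∣image∣ : ∀ {ρ : Vec (Fin n) k} → Uniqueᵛ ρ → ∀ c → ∣ image ρ c ∣ ≡ ∣ c ∣
∣image∣ {n = n} {ρ = []} _ [] = ∣⊥∣≡0 n
∣image∣ {ρ = _ ∷ _} (x∉ρ ∷ uρ) (inside  ∷ c) = trans (∣⁅x⁆∪p∣ (∉-image x∉ρ c)) (cong suc (∣image∣ uρ c))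
∣image∣ {ρ = _ ∷ _} (_   ∷ uρ) (outside ∷ c) = ∣image∣ uρ c

range? : ∀ (ρ : Vec (Fin n) k) x → Allᵛ (x ≢_) ρ ⊎ ∃ λ i → lookup ρ i ≡ x
range? ρ x with Allᵛ.decide (λ y → swap (toSum (x ≟ᶠ y))) ρ
... | inj₁ x∉ρ = inj₁ x∉ρ
... | inj₂ x∈ρ = inj₂ (Anyᵛ.index x∈ρ , sym (lookup-index x∈ρ))

record Covering (ρ : Vec (Fin n) k) (b : Subset n) : Set where
  field
    {j}    : ℕ
    new    : Vec (Fin n) j
    old    : Subset k
    unique : Uniqueᵛ (new ++ ρ)
    new⊆b  : Allᵛ (_∈ b) new
    image≡ : image (new ++ ρ) (⊤ ++ old) ≡ b

preimage : Vec (Fin n) k → Subset n → Subset k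
preimage ρ b = mapᵛ (lookup b) ρ

∈-preimage⁺ : ∀ (ρ : Vec (Fin n) k) {b i} → lookup ρ i ∈ b → i ∈ preimage ρ b
∈-preimage⁺ ρ {b} {i} ρi∈b = lookup⇒[]= i _ (trans (lookup-map i (lookup b) ρ) ([]=⇒lookup ρi∈b))

∈-preimage⁻ : ∀ (ρ : Vec (Fin n) k) {b i} → i ∈ preimage ρ b → lookup ρ i ∈ b
∈-preimage⁻ ρ {b} {i} i∈ = lookup⇒[]= (lookup ρ i) b (trans (sym (lookup-map i (lookup b) ρ)) ([]=⇒lookup i∈))

image-preimage : ∀ (ρ : Vec (Fin n) k) {b} → (∀ {x} → x ∈ b → ∃ λ i → lookup ρ i ≡ x) → image ρ (preimage ρ b) ≡ b
image-preimage ρ {b} b⊆ρ = ⊆-antisym ρρ⁻¹b⊆b b⊆ρρ⁻¹b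
  where
  ρρ⁻¹b⊆b : image ρ (preimage ρ b) ⊆ b
  ρρ⁻¹b⊆b x∈ with ∈-image⁻ ρ _ x∈
  ... | _ , i∈ , refl = ∈-preimage⁻ ρ i∈
  b⊆ρρ⁻¹b : b ⊆ image ρ (preimage ρ b)
  b⊆ρρ⁻¹b x∈b with b⊆ρ x∈b
  ... | _ , refl = ∈-image⁺ ρ _ (∈-preimage⁺ ρ x∈b)

covering : ∀ {ρ : Vec (Fin n) k} → Uniqueᵛ ρ → ∀ b → Covering ρ b
covering {ρ = ρ} uρ b = go b (<-wellFounded ∣ b ∣)
  where
  go : ∀ b → Acc _<_ ∣ b ∣ → Covering ρ b
  go b (acc smaller) with anyFin? (λ x → x ∈? b ×-dec Allᵛ.all? (λ y → ¬? (x ≟ᶠ y)) ρ)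
  ... | yes (x , x∈b , x∉ρ) = record
    { new    = x ∷ new
    ; old    = old
    ; unique = ++⁺ x∉new x∉ρ ∷ unique
    ; new⊆b  = x∈b ∷ Allᵛ.map (p─q⊆p b ⁅ x ⁆) new⊆b
    ; image≡ = trans (cong (⁅ x ⁆ ∪_) image≡) (⁅x⁆∪[p-x]≡p x∈b)
    }
    where
    open Covering (go (b - x) (smaller (x∈p⇒∣p-x∣<∣p∣ x∈b)))
    x∉new : Allᵛ (x ≢_) new
    x∉new = Allᵛ.map (λ y∈b-x x≡y → x∉p-x b (subst (_∈ b - x) (sym x≡y) y∈b-x)) new⊆b
  ... | no ∄ = record
    { new = [] ; old = preimage ρ b ; unique = uρ ; new⊆b = [] ; image≡ = image-preimage ρ b⊆ρ }
    where
    b⊆ρ : ∀ {x} → x ∈ b → ∃ λ i → lookup ρ i ≡ x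
    b⊆ρ {x} x∈b = [ (λ x∉ρ → contradiction (x , x∈b , x∉ρ) ∄) , id ]′ (range? ρ x)

_≟ˢ_ : DecidableEquality (Subset k)
_≟ˢ_ = ≡-dec _≟ᵇ_

OddTriple : List (Subset k) → Subset k → Set
OddTriple L S = ∣ S ∣ ≡ 3 × ¬ 2 ∣ deg S L

oddTriple? : (L : List (Subset k)) → Decidable (OddTriple L)
oddTriple? L S = ∣ S ∣ ≟ 3 ×-dec ¬? (2 ∣? deg S L)

-- A 3-set contained in no block of L has degree 0, so only faces of blocks can be odd.
faces : Subset k → List (Subset k)
faces b = map (b -_) (filter (_∈? b) (allFin _))

subsetsOfSize : (k m : ℕ) → List (Subset k)
subsetsOfSize zero    zero    = [] ∷ []
subsetsOfSize zero    (suc m) = []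
subsetsOfSize (suc k) zero    = map (outside ∷_) (subsetsOfSize k zero)
subsetsOfSize (suc k) (suc m) = map (inside ∷_) (subsetsOfSize k m) ++ᴸ map (outside ∷_) (subsetsOfSize k (suc m))

arrangements : (k m : ℕ) → List (Vec (Fin k) m)
arrangements k zero    = [] ∷ []
arrangements k (suc m) =
  concatMap (λ σ → map (_∷ σ) (filter (λ x → ¬? (Anyᵛ.any? (x ≟ᶠ_) σ)) (allFin k))) (arrangements k m)

CopyOfP : List (Subset k) → Vec (Fin k) 6 → Set
CopyOfP L σ = Uniqueᵛ σ × All (λ p → image σ p ∈ᴸ L) P × All (λ l → Any (λ p → l ≡ image σ p) P) L

copyOfP? : (L : List (Subset k)) → Decidable (CopyOfP L)
copyOfP? L σ = allPairs? (λ x y → ¬? (x ≟ᶠ y)) σ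
         ×-dec All.all? (λ p → any? (image σ p ≟ˢ_) L) P
         ×-dec All.all? (λ l → any? (λ p → l ≟ˢ image σ p) P) L

mutual
  closes : ℕ → List (Subset k) → Bool
  closes r L = closesAt r L (find (oddTriple? L) (concatMap faces L))

  closesAt : ℕ → List (Subset k) → Maybe (Subset k) → Bool
  closesAt zero    L (just _) = true
  closesAt zero    L nothing  = isYes (any? (copyOfP? L) (arrangements _ 6))
  closesAt (suc r) L (just S) =
    all (closesWithOldPoint r L S) (allFin _) ∧ closesWith r (map (outside ∷_) L) (inside ∷ S)
  closesAt (suc r) L nothing  = all (closesWithNewPoints r L) (upTo 5)

  closesWithOldPoint : ℕ → List (Subset k) → Subset k → Fin k → Bool
  closesWithOldPoint r L S i = isYes (i ∈? S) ∨ closesWith r L (⁅ i ⁆ ∪ S)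

  -- The j new points are placed before the old ones, which pads the old blocks with ⊥.
  closesWithNewPoints : ℕ → List (Subset k) → ℕ → Bool
  closesWithNewPoints {k} r L j =
    all (λ d → closesWith r (map (⊥ {n = j} ++_) L) (⊤ ++ d)) (subsetsOfSize k (4 ∸ j))

  closesWith : ℕ → List (Subset k) → Subset k → Bool
  closesWith r L b = isYes (any? (b ≟ˢ_) L) ∨ closes r (b ∷ L)

find-sound : ∀ {a p} {A : Set a} {P : Pred A p} (P? : Decidable P) xs → Maybe.All P (find P? xs)
find-sound P? []       = nothing
find-sound P? (x ∷ xs) with P? x
... | yes px = just px
... | no  _  = find-sound P? xs

∈-subsetsOfSize : ∀ (d : Subset k) → d ∈ᴸ subsetsOfSize k ∣ d ∣
∈-subsetsOfSize []            = here refl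
∈-subsetsOfSize (inside  ∷ d) = ∈-++⁺ˡ (∈-map⁺ (inside ∷_) (∈-subsetsOfSize d))
∈-subsetsOfSize (outside ∷ d) = prepend-outside ∣ d ∣ (∈-subsetsOfSize d)
  where
  prepend-outside : ∀ m → d ∈ᴸ subsetsOfSize _ m → (outside ∷ d) ∈ᴸ subsetsOfSize _ m
  prepend-outside zero    d∈ = ∈-map⁺ (outside ∷_) d∈
  prepend-outside (suc m) d∈ = ∈-++⁺ʳ _ (∈-map⁺ (outside ∷_) d∈)

deg-image : ∀ {ρ : Vec (Fin n) k} → Uniqueᵛ ρ → ∀ S L → deg (image ρ S) (map (image ρ) L) ≡ deg S L
deg-image uρ S [] = refl
deg-image {ρ = ρ} uρ S (l ∷ L) with image ρ S ⊆? image ρ l | S ⊆? l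
... | yes _      | yes _   = cong suc (deg-image uρ S L)
... | no  _      | no  _   = deg-image uρ S L
... | yes ρS⊆ρl | no S⊈l  = ⊥-elim (S⊈l (image-⊆⁻ uρ ρS⊆ρl))
... | no ρS⊈ρl  | yes S⊆l = ⊥-elim (ρS⊈ρl (image-⊆⁺ ρ S⊆l))

record Embeds (ρ : Vec (Fin n) k) (L : List (Subset k)) (U : List (Subset n)) : Set where
  field
    injective : Uniqueᵛ ρ
    distinct  : Unique (map (image ρ) L)
    ⊆U        : map (image ρ) L ⊆ᴸ U

open Embeds

Embeds-∷ : ∀ {ρ : Vec (Fin n) k} {L U c} → Embeds ρ L U → image ρ c ∈ᴸ U → image ρ c ∉ᴸ map (image ρ) L →
           Embeds ρ (c ∷ L) U
Embeds-∷ emb c∈U c∉ = record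
  { injective = injective emb
  ; distinct  = ∉⇒All≢ c∉ ∷ distinct emb
  ; ⊆U        = λ { (here refl) → c∈U ; (there b∈) → ⊆U emb b∈ }
  }

Embeds-reindex : ∀ {m} {ρ : Vec (Fin n) k} {ρ′ : Vec (Fin n) m} {L L′ U} → Uniqueᵛ ρ′ →
                 map (image ρ′) L′ ≡ map (image ρ) L → Embeds ρ L U → Embeds ρ′ L′ U
Embeds-reindex uρ′ eq emb = record
  { injective = uρ′
  ; distinct  = subst Unique (sym eq) (distinct emb)
  ; ⊆U        = λ b∈ → ⊆U emb (subst (_ ∈ᴸ_) eq b∈)
  }

-- r is the number of blocks of U that are not yet images of blocks of L.
Closes : ℕ → List (Subset k) → Set
Closes {k} r L = ∀ {n} {U : List (Subset n)} {ρ : Vec (Fin n) k} →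
                 Unitrade 4 n U → Embeds ρ L U → length U ≡ r + length L → Equivalent U P

Sound : ℕ → Set
Sound r = ∀ {k} (L : List (Subset k)) → T (closes r L) → Closes r L

OddTriple⇒missing-block : ∀ {U : List (Subset n)} {ρ : Vec (Fin n) k} {L S} → Unitrade 4 n U → Embeds ρ L U →
                          OddTriple L S → ∃ λ b → b ∈ᴸ U × image ρ S ⊆ b × b ∉ᴸ map (image ρ) L
OddTriple⇒missing-block {U = U} {ρ} {L} {S} ut emb (∣S∣≡3 , odd) =
  length-filter≢⇒∃∉ _≟ˢ_ (image ρ S ⊆?_) (distinct emb) (Unitrade.distinct ut) (⊆U emb) degrees-differ
  where
  degrees-differ : deg (image ρ S) (map (image ρ) L) ≢ deg (image ρ S) U
  degrees-differ eq = odd (subst (2 ∣_) (trans (sym eq) (deg-image (injective emb) S L))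
    (Unitrade.even ut (image ρ S) (cong (_+ 1) (trans (∣image∣ (injective emb) S) ∣S∣≡3))))

Embeds-exhaustive : ∀ {U : List (Subset n)} {ρ : Vec (Fin n) k} {L} → Embeds ρ L U → length U ≡ length L →
                    U ⊆ᴸ map (image ρ) L
Embeds-exhaustive {ρ = ρ} {L} emb ∣U∣≡∣L∣ =
  ⊆∧length≥⇒⊇ _≟ˢ_ (distinct emb) (⊆U emb) (≤-reflexive (trans ∣U∣≡∣L∣ (sym (length-map (image ρ) L))))

CopyOfP⇒Equivalent : ∀ {U : List (Subset n)} {ρ : Vec (Fin n) k} {L σ} → CopyOfP L σ → Embeds ρ L U →
                     U ⊆ᴸ map (image ρ) L → Equivalent U P
CopyOfP⇒Equivalent {U = U} {ρ} {L} {σ} (uσ , P↦L , L↦P) emb U⊆ = inj₂ (lookup τ , τ-injective , to , from)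
  where
  τ : Vec (Fin _) 6
  τ = mapᵛ (lookup ρ) σ
  τ-injective : Injective _≡_ _≡_ (lookup τ)
  τ-injective = lookup-injective (map⁺ (lookup-injective (injective emb) _ _) uσ) _ _
  to : ∀ s → s ∈ᴸ U → ∃ λ u → u ∈ᴸ P × IsImage (lookup τ) u s
  to s s∈U with ∈-map⁻ (image ρ) (U⊆ s∈U)
  ... | l , l∈L , refl with find∈ (All.lookup L↦P l∈L)
  ... | p , p∈P , refl = p , p∈P , subst (IsImage (lookup τ) p) (sym (image-map ρ σ p)) (image-isImage τ p)
  from : ∀ u → u ∈ᴸ P → ∃ λ s → s ∈ᴸ U × IsImage (lookup τ) u s
  from u u∈P = image τ u , subst (_∈ᴸ U) (image-map ρ σ u) (⊆U emb (∈-map⁺ (image ρ) (All.lookup P↦L u∈P))) ,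
               image-isImage τ u

closesWith-sound : ∀ {r} → Sound r → ∀ {U : List (Subset n)} {ρ : Vec (Fin n) k} {L c} → T (closesWith r L c) →
                   Unitrade 4 n U → Embeds ρ L U → image ρ c ∈ᴸ U → image ρ c ∉ᴸ map (image ρ) L →
                   length U ≡ suc r + length L → Equivalent U P
closesWith-sound {r = r} sound {ρ = ρ} {L} {c} t ut emb c∈U c∉ ∣U∣≡ with Equivalence.to T-∨ t
... | inj₁ c∈L = contradiction (∈-map⁺ (image ρ) (toWitness {a? = any? (c ≟ˢ_) L} c∈L)) c∉
... | inj₂ t′  = sound (c ∷ L) t′ ut (Embeds-∷ emb c∈U c∉) (trans ∣U∣≡ (sym (+-suc r (length L))))

block-through-triple-sound : ∀ {r} → Sound r → ∀ {U : List (Subset n)} {ρ : Vec (Fin n) k} {L S v} →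
                             T (closesAt (suc r) L (just S)) → Unitrade 4 n U → Embeds ρ L U →
                             v ∉ image ρ S → ⁅ v ⁆ ∪ image ρ S ∈ᴸ U → ⁅ v ⁆ ∪ image ρ S ∉ᴸ map (image ρ) L →
                             length U ≡ suc r + length L → Equivalent U P
block-through-triple-sound {r = r} sound {U = U} {ρ} {L} {S} {v} t ut emb v∉ρS b∈U b∉ ∣U∣≡ with range? ρ v
... | inj₂ (i , refl) = closesWith-sound sound old-point ut emb
      (subst (_∈ᴸ U) (sym ρc≡b) b∈U) (subst (_∉ᴸ _) (sym ρc≡b) b∉) ∣U∣≡
  where
  ρc≡b : image ρ (⁅ i ⁆ ∪ S) ≡ ⁅ lookup ρ i ⁆ ∪ image ρ S
  ρc≡b = image-⁅⁆∪ ρ i S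
  old-point : T (closesWith r L (⁅ i ⁆ ∪ S))
  old-point with Equivalence.to T-∨
                  (All.lookup (all⁺ (closesWithOldPoint r L S) _ (proj₁ (Equivalence.to T-∧ t))) (∈-allFin i))
  ... | inj₁ i∈S = contradiction (∈-image⁺ ρ S (toWitness {a? = i ∈? S} i∈S)) v∉ρS
  ... | inj₂ ext = ext
... | inj₁ v∉ρ = closesWith-sound sound (proj₂ (Equivalence.to T-∧ t)) ut
      (Embeds-reindex (v∉ρ ∷ injective emb) forget-v emb) b∈U (subst (_ ∉ᴸ_) (sym forget-v) b∉)
      (trans ∣U∣≡ (cong (suc r +_) (sym (length-map (outside ∷_) L))))
  where
  forget-v : map (image (v ∷ ρ)) (map (outside ∷_) L) ≡ map (image ρ) L
  forget-v = sym (map-∘ L)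

oddTriple-sound : ∀ {r} → Sound r → ∀ {L : List (Subset k)} {S} → OddTriple L S → T (closesAt (suc r) L (just S)) →
                  Closes (suc r) L
oddTriple-sound sound {S = S} odd@(∣S∣≡3 , _) t {U = U} {ρ} ut emb ∣U∣≡
  with b , b∈U , ρS⊆b , b∉ ← OddTriple⇒missing-block ut emb odd =
  let v , v∉ρS , ⁅v⁆∪ρS≡b = p⊆q∧∣q∣≡1+∣p∣⇒q≡⁅x⁆∪p ρS⊆b ∣b∣≡1+∣ρS∣
  in block-through-triple-sound sound t ut emb v∉ρS
       (subst (_∈ᴸ U) (sym ⁅v⁆∪ρS≡b) b∈U) (subst (_∉ᴸ _) (sym ⁅v⁆∪ρS≡b) b∉) ∣U∣≡
  where
  ∣b∣≡1+∣ρS∣ : ∣ b ∣ ≡ suc ∣ image ρ S ∣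
  ∣b∣≡1+∣ρS∣ = trans (All.lookup (Unitrade.blockSize ut) b∈U)
                     (cong suc (sym (trans (∣image∣ (injective emb) S) ∣S∣≡3)))

missing-block-sound : ∀ {r} → Sound r → ∀ {U : List (Subset n)} {ρ : Vec (Fin n) k} {L b} →
                      T (closesAt (suc r) L nothing) → Unitrade 4 n U → Embeds ρ L U →
                      b ∈ᴸ U → b ∉ᴸ map (image ρ) L → length U ≡ suc r + length L → Equivalent U P
missing-block-sound {k = k} {r} sound {U = U} {ρ} {L} {b} t ut emb b∈U b∉ ∣U∣≡ =
  closesWith-sound sound new-block ut (Embeds-reindex unique forget-new emb)
    (subst (_∈ᴸ U) (sym image≡) b∈U) (subst₂ _∉ᴸ_ (sym image≡) (sym forget-new) b∉)
    (trans ∣U∣≡ (cong (suc r +_) (sym (length-map (⊥ ++_) L))))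
  where
  open Covering (covering (injective emb) b)
  forget-new : map (image (new ++ ρ)) (map (⊥ ++_) L) ≡ map (image ρ) L
  forget-new = trans (sym (map-∘ L)) (map-cong (image-⊥++ new ρ) L)
  j+∣old∣≡4 : j + ∣ old ∣ ≡ 4
  j+∣old∣≡4 = begin
    j + ∣ old ∣                       ≡⟨ ∣⊤++p∣ j old ⟨
    ∣ ⊤ {n = j} ++ old ∣              ≡⟨ ∣image∣ unique (⊤ ++ old) ⟨
    ∣ image (new ++ ρ) (⊤ ++ old) ∣   ≡⟨ cong ∣_∣ image≡ ⟩
    ∣ b ∣                             ≡⟨ All.lookup (Unitrade.blockSize ut) b∈U ⟩
    4                                 ∎
  j≤4 : j ≤ 4
  j≤4 = subst (j ≤_) j+∣old∣≡4 (m≤m+n j ∣ old ∣)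
  ∣old∣≡4∸j : ∣ old ∣ ≡ 4 ∸ j
  ∣old∣≡4∸j = trans (sym (m+n∸m≡n j ∣ old ∣)) (cong (_∸ j) j+∣old∣≡4)
  new-block : T (closesWith r (map (⊥ {n = j} ++_) L) (⊤ ++ old))
  new-block = All.lookup (all⁺ (λ d → closesWith r (map (⊥ ++_) L) (⊤ ++ d)) _
                           (All.lookup (all⁺ (closesWithNewPoints r L) _ t) (∈-upTo⁺ (s≤s j≤4))))
                (subst (λ m → old ∈ᴸ subsetsOfSize k m) ∣old∣≡4∸j (∈-subsetsOfSize old))

noOddTriple-sound : ∀ {r} → Sound r → ∀ {L : List (Subset k)} → T (closesAt (suc r) L nothing) → Closes (suc r) L
noOddTriple-sound {r = r} sound {L} t {ρ = ρ} ut emb ∣U∣≡ =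
  let b , b∈U , b∉ = length<⇒∃∉ _≟ˢ_ (Unitrade.distinct ut)
                       (subst₂ _<_ (sym (length-map (image ρ) L)) (sym ∣U∣≡) (s≤s (m≤n+m (length L) r)))
  in missing-block-sound sound t ut emb b∈U b∉ ∣U∣≡

mutual
  closes-sound : ∀ r → Sound r
  closes-sound r L = closesAt-sound r L _ (find-sound (oddTriple? L) (concatMap faces L))

  closesAt-sound : ∀ r (L : List (Subset k)) m → Maybe.All (OddTriple L) m → T (closesAt r L m) → Closes r L
  closesAt-sound zero    L (just _) (just odd) _ ut emb ∣U∣≡ =
    let b , b∈U , _ , b∉ = OddTriple⇒missing-block ut emb odd in contradiction (Embeds-exhaustive emb ∣U∣≡ b∈U) b∉
  closesAt-sound zero    L nothing  _ t ut emb ∣U∣≡ =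
    let _ , _ , copy = find∈ (toWitness {a? = any? (copyOfP? L) (arrangements _ 6)} t)
    in CopyOfP⇒Equivalent copy emb (Embeds-exhaustive emb ∣U∣≡)
  closesAt-sound (suc r) L (just _) (just odd) t = oddTriple-sound (closes-sound r) odd t
  closesAt-sound (suc r) L nothing  _          t = noOddTriple-sound (closes-sound r) t

P-unitrade : Unitrade 4 6 P
P-unitrade = record
  { distinct  = toWitness {a? = AllPairs.allPairs? (λ b c → ¬? (b ≟ˢ c)) P} _
  ; blockSize = toWitness {a? = All.all? (λ b → ∣ b ∣ ≟ 4) P} _
  ; even      = λ S ∣S∣+1≡4 → All.lookup (toWitness {a? = All.all? (λ S → 2 ∣? deg S P) (subsetsOfSize 6 3)} _)
                  (subst (λ m → S ∈ᴸ subsetsOfSize 6 m) (+-cancelʳ-≡ 1 ∣ S ∣ 3 ∣S∣+1≡4) (∈-subsetsOfSize S))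
  }

-- The argument _ : T (closes 9 []) is found by evaluating the search.
proposition13 : Unitrade 4 6 P × (∀ (n : ℕ) (U : List (Subset n)) → Unitrade 4 n U → length U ≡ 9 → Equivalent U P)
proposition13 = P-unitrade , λ n U ut ∣U∣≡9 →
  closes-sound 9 [] _ ut (record { injective = [] ; distinct = [] ; ⊆U = λ () }) ∣U∣≡9
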